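{- Let $l\ge 2$ be an integer, let $T$ be a maximal outerplanar graph of order $n\ge 2l$, and let $u_iu_{i+1}$ be a boundary edge of $T$. Then there exists a diagonal of $T$ that splits $T$ into two maximal outerplanar graphs, one of which does not contain the edge $u_iu_{i+1}$ and has order $h$ for some $h\in\{l+1,\dots,2l-1\}$.
   Context: A maximal outerplanar graph (MOP) is a biconnected planar graph with a plane embedding in which all vertices lie on the boundary cycle of the outer face and all bounded faces are triangles. Boundary edges are the edges of the outer boundary cycle; a diagonal is an edge joining two non-consecutive vertices of the boundary cycle. A diagonal splits the MOP into two MOPs sharing that diagonal. -}

module Defs where

open import Data.Nat using (ℕ; zero; suc; _+_; _*_; _∸_; _≤_; _<_)
open import Data.Product using (_×_)
open import Data.Sum using (_⊎_)
open import Relation.Binary.PropositionalEquality using (_≡_)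
open import Relation.Nullary using (¬_)

-- A maximal outerplanar graph (MOP) of order n is modelled, up to
-- isomorphism, by labelling its vertices 0,1,…,n-1 in the order of the
-- boundary (Hamiltonian) cycle of the outer face.  Its bounded faces are
-- triangles, so it is a triangulation of the convex polygon 0,1,…,n-1.
--
-- Triang a b : a triangulation of the polygon with vertices a, a+1, …, b
-- (consecutive labels), whose side {a,b} is the "root" edge.
--   * seg      : the degenerate polygon a, a+1 (a single edge);
--   * apex c   : the triangle {a,c,b} is the face on the root edge {a,b},
--                and the polygons a..c and c..b are triangulated recursively.
data Triang : ℕ → ℕ → Set where
  seg  : (a : ℕ) → Triang a (suc a)
  apex : {a b : ℕ} (c : ℕ) → a < c → c < b → Triang a c → Triang c b → Triang a b

data Edge : {a b : ℕ} → Triang a b → ℕ → ℕ → Set where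
  seg-edge  : (a : ℕ) → Edge (seg a) a (suc a)
  apex-root : {a b c : ℕ} {p : a < c} {q : c < b} {l : Triang a c} {r : Triang c b} →
              Edge (apex c p q l r) a b
  apex-left : {a b c x y : ℕ} {p : a < c} {q : c < b} {l : Triang a c} {r : Triang c b} →
              Edge l x y → Edge (apex c p q l r) x y
  apex-right : {a b c x y : ℕ} {p : a < c} {q : c < b} {l : Triang a c} {r : Triang c b} →
              Edge r x y → Edge (apex c p q l r) x y

MOP : ℕ → Set
MOP n = Triang 0 (n ∸ 1)

-- {a,b} (a < b) is a diagonal of T: an edge of T joining two vertices that
-- are not consecutive on the boundary cycle 0,1,…,n-1,0.
Diagonal : (n : ℕ) → MOP n → ℕ → ℕ → Set
Diagonal n T a b = (a < b) × Edge T a b × (suc a < b) × ¬ ((a ≡ 0) × (b ≡ n ∸ 1))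

-- A diagonal {a,b} (a < b) splits T into two MOPs sharing {a,b}:
--   the inner part, on the boundary vertices a, a+1, …, b, and
--   the outer part, on the boundary vertices b, b+1, …, n-1, 0, 1, …, a.
innerOrder : ℕ → ℕ → ℕ
innerOrder a b = suc (b ∸ a)

outerOrder : ℕ → ℕ → ℕ → ℕ
outerOrder n a b = suc (n ∸ (b ∸ a))

-- The boundary edge u_i u_{i+1} (indices mod n; i < n) is the edge
-- {i, i+1} for i < n-1 and {n-1, 0} for i = n-1.
-- It lies in the inner part iff a ≤ i < b, and in the outer part iff
-- i < a or b ≤ i.
innerHasBoundaryEdge : ℕ → ℕ → ℕ → Set
innerHasBoundaryEdge a b i = (a ≤ i) × (i < b)

outerHasBoundaryEdge : ℕ → ℕ → ℕ → Set
outerHasBoundaryEdge a b i = (i < a) ⊎ (b ≤ i)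

{-# OPTIONS --safe #-}
-- A chord {x,y} cuts the boundary cycle 0,1,…,n−1 into the arcs x..y and y..n+x (indices
-- mod n); we need a chord one of whose arcs spans between l and 2l−2 edges and avoids the
-- boundary edge i. Inside a triangulated sub-polygon spanning at least l edges such a chord
-- exists: if the root edge is too long, one side of the root triangle still spans at least l.
-- To avoid i, descend from the root triangle of T through sub-polygons a..b that contain i
-- while the complementary arc b..n+a spans fewer than l edges. At the triangle on a..b with
-- apex c, either the side away from i spans at least l (look inside it), or the side towards
-- i still has a short complementary arc (descend), or that arc spans between l and 2l−2
-- edges, since it exceeds b..n+a by the span of the short side away from i.
module Submission where

open import Defs
open import Data.Nat using (ℕ; zero; suc; _+_; _*_; _∸_; _≤_; _<_; z≤n; s≤s; _≤?_; _<?_)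
open import Data.Nat.Properties
open import Data.Nat.Tactic.RingSolver using (solve)
open import Data.List using ([]; _∷_)
open import Data.Product using (_×_; ∃-syntax; _,_; proj₁; proj₂)
open import Data.Sum using (_⊎_; inj₁; inj₂)
open import Function using (id; _∘_)
open import Relation.Nullary using (¬_; yes; no; contradiction)
open import Relation.Binary.PropositionalEquality using (_≡_; refl; sym; cong; cong₂; subst; module ≡-Reasoning)

private variable a b c d x y l : ℕ

root-edge : (t : Triang a b) → Edge t a b
root-edge (seg a)          = seg-edge a
root-edge (apex _ _ _ _ _) = apex-root

edge-bounds : {t : Triang a b} → Edge t x y → a ≤ x × y ≤ b
edge-bounds (seg-edge a) = ≤-refl , ≤-refl
edge-bounds apex-root    = ≤-refl , ≤-refl
edge-bounds (apex-left {q = c<b} e) with edge-bounds e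
... | a≤x , y≤c = a≤x , ≤-trans y≤c (<⇒≤ c<b)
edge-bounds (apex-right {p = a<c} e) with edge-bounds e
... | c≤x , y≤b = ≤-trans (<⇒≤ a<c) c≤x , y≤b

_⊆ᴱ_ : Triang a b → Triang c d → Set
t ⊆ᴱ u = ∀ {x y} → Edge t x y → Edge u x y

cancel-≤ : ∀ {p q r s} k → p ≤ q → p ≡ r + k → q ≡ s + k → r ≤ s
cancel-≤ {r = r} {s} k p≤q refl refl = +-cancelʳ-≤ k r s p≤q

Window : ℕ → ℕ → Set
Window l h = suc l ≤ h × h ≤ 2 * l ∸ 1

-- The polygon x, x+1, …, y has between l+1 and 2l−1 vertices, stated without subtraction.
Fits : ℕ → ℕ → ℕ → Set
Fits l x y = l + x ≤ y × y + 2 ≤ x + 2 * l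

Fits⇒Window : Fits l x y → Window l (innerOrder x y)
Fits⇒Window {l} {x} {y} (l+x≤y , y+2≤x+2l) = s≤s (m+n≤o⇒m≤o∸n l l+x≤y) , m+n≤o⇒m≤o∸n _ upper
  where
  open ≤-Reasoning
  x≤y : x ≤ y
  x≤y = ≤-trans (m≤n+m x l) l+x≤y
  upper : suc (y ∸ x) + 1 ≤ 2 * l
  upper = begin
    suc (y ∸ x) + 1  ≡⟨ +-suc (y ∸ x) 1 ⟨
    y ∸ x + 2        ≡⟨ +-∸-comm 2 x≤y ⟨
    y + 2 ∸ x        ≤⟨ ∸-monoˡ-≤ x y+2≤x+2l ⟩
    x + 2 * l ∸ x    ≡⟨ m+n∸m≡n x (2 * l) ⟩
    2 * l            ∎

outerOrder≡innerOrder : ∀ n → x ≤ y → outerOrder n x y ≡ innerOrder y (n + x)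
outerOrder≡innerOrder {x} {y} n x≤y = cong suc (begin
  n ∸ (y ∸ x)            ≡⟨ [m+n]∸[m+o]≡n∸o x n (y ∸ x) ⟨
  x + n ∸ (x + (y ∸ x))  ≡⟨ cong₂ _∸_ (+-comm x n) (m+[n∸m]≡n x≤y) ⟩
  n + x ∸ y              ∎)
  where open ≡-Reasoning

ShortChord : ℕ → Triang a b → Set
ShortChord l t = ∃[ x ] ∃[ y ] (Edge t x y × Fits l x y)

ShortChord-⊆ : {t : Triang a b} {u : Triang c d} → t ⊆ᴱ u → ShortChord l t → ShortChord l u
ShortChord-⊆ t⊆u (x , y , e , fits) = x , y , t⊆u e , fits

short-chord : 2 ≤ l → (t : Triang a b) → l + a ≤ b → ShortChord l t
short-chord 2≤l (seg a) l+a≤1+a = contradiction (cancel-≤ a l+a≤1+a refl refl) (<⇒≱ 2≤l)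
short-chord {l} {a} {b} 2≤l (apex c _ _ L R) l+a≤b with b + 2 ≤? a + 2 * l | l + a ≤? c
... | yes b+2≤a+2l | _         = a , b , apex-root , l+a≤b , b+2≤a+2l
... | no _         | yes l+a≤c = ShortChord-⊆ apex-left (short-chord 2≤l L l+a≤c)
... | no b+2≰a+2l  | no l+a≰c  = ShortChord-⊆ apex-right (short-chord 2≤l R l+c≤b)
  where
  l+c≤b : l + c ≤ b
  l+c≤b = cancel-≤ (a + l + 2) (+-mono-≤ (≰⇒> l+a≰c) (≰⇒> b+2≰a+2l))
            (solve (l ∷ a ∷ c ∷ [])) (solve (l ∷ a ∷ b ∷ []))

SplittingDiagonal : (l n : ℕ) → MOP n → ℕ → Set
SplittingDiagonal l n T i = ∃[ a ] ∃[ b ] (Diagonal n T a b ×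
  ((¬ innerHasBoundaryEdge a b i × Window l (innerOrder a b))
   ⊎ (¬ outerHasBoundaryEdge a b i × Window l (outerOrder n a b))))

module _ {l m : ℕ} (2≤l : 2 ≤ l) (2l≤n : 2 * l ≤ suc m) {T : MOP (suc m)} {i : ℕ} where

  inner-split : Edge T x y → Fits l x y → ¬ innerHasBoundaryEdge x y i → SplittingDiagonal l (suc m) T i
  inner-split {x} {y} e fits@(l+x≤y , y+2≤x+2l) i∉ =
    x , y , (<⇒≤ 1+x<y , e , 1+x<y , not-whole) , inj₁ (i∉ , Fits⇒Window fits)
    where
    1+x<y : suc x < y
    1+x<y = ≤-trans (+-monoˡ-≤ x 2≤l) l+x≤y
    not-whole : ¬ (x ≡ 0 × y ≡ m)
    not-whole (refl , refl) = 1+n≰n (cancel-≤ m (≤-trans y+2≤x+2l 2l≤n) (+-comm m 2) refl)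

  outer-split : Edge T x y → Fits l y (suc m + x) → x ≤ i → i < y → SplittingDiagonal l (suc m) T i
  outer-split {x} {y} e fits@(l+y≤n+x , n+x+2≤y+2l) x≤i i<y =
    x , y , (≤-trans (s≤s x≤i) i<y , e , 1+x<y , not-whole) , inj₂ (i∉ , window)
    where
    1+x<y : suc x < y
    1+x<y = cancel-≤ (suc m) (≤-trans n+x+2≤y+2l (+-monoʳ-≤ y 2l≤n))
              (solve (m ∷ x ∷ [])) refl
    not-whole : ¬ (x ≡ 0 × y ≡ m)
    not-whole (refl , refl) = <⇒≱ 2≤l (cancel-≤ m l+y≤n+x refl (cong suc (+-identityʳ m)))
    i∉ : ¬ outerHasBoundaryEdge x y i
    i∉ (inj₁ i<x) = <⇒≱ i<x x≤i
    i∉ (inj₂ y≤i) = <⇒≱ i<y y≤i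
    window : Window l (outerOrder (suc m) x y)
    window = subst (Window l) (sym (outerOrder≡innerOrder (suc m) (≤-trans x≤i (<⇒≤ i<y))))
                   (Fits⇒Window fits)

  split-avoiding : (t : Triang a b) → t ⊆ᴱ T → l + a ≤ b → i < a ⊎ b ≤ i → SplittingDiagonal l (suc m) T i
  split-avoiding {a} {b} t t⊆T l+a≤b i-outside with short-chord 2≤l t l+a≤b
  ... | x , y , e , fits = inner-split (t⊆T e) fits (i∉ i-outside)
    where
    i∉ : i < a ⊎ b ≤ i → ¬ innerHasBoundaryEdge x y i
    i∉ (inj₁ i<a) (x≤i , _)  = <⇒≱ i<a (≤-trans (proj₁ (edge-bounds e)) x≤i)
    i∉ (inj₂ b≤i) (_ , i<y)  = <⇒≱ i<y (≤-trans (proj₂ (edge-bounds e)) b≤i)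

  split-containing : (t : Triang a b) → t ⊆ᴱ T → a ≤ i → i < b → suc m + a < l + b → SplittingDiagonal l (suc m) T i
  split-containing (seg a) _ _ _ n+a<l+1+a = contradiction (≤-trans l≤0 z≤n) (<⇒≱ 2≤l)
    where
    n≤l : suc m ≤ l
    n≤l = cancel-≤ (suc a) n+a<l+1+a (solve (m ∷ a ∷ [])) refl
    l≤0 : l ≤ 0
    l≤0 = cancel-≤ l (≤-trans 2l≤n n≤l) (solve (l ∷ [])) refl
  split-containing {a} {b} (apex c _ _ L R) t⊆T a≤i i<b n+a<l+b with i <? c
  ... | yes i<c with l + c ≤? b | suc m + a <? l + c
  ...   | yes l+c≤b | _           = split-avoiding R (t⊆T ∘ apex-right) l+c≤b (inj₁ i<c)
  ...   | no _      | yes n+a<l+c = split-containing L (t⊆T ∘ apex-left) a≤i i<c n+a<l+c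
  ...   | no l+c≰b  | no n+a≮l+c  =
          outer-split (t⊆T (apex-left (root-edge L))) (≮⇒≥ n+a≮l+c , n+a+2≤c+2l) a≤i i<c
    where
    n+a+2≤c+2l : suc m + a + 2 ≤ c + 2 * l
    n+a+2≤c+2l = cancel-≤ b (+-mono-≤ n+a<l+b (≰⇒> l+c≰b))
                   (solve (m ∷ a ∷ b ∷ [])) (solve (l ∷ b ∷ c ∷ []))
  split-containing {a} {b} (apex c _ _ L R) t⊆T a≤i i<b n+a<l+b | no i≮c with l + a ≤? c | suc m + c <? l + b
  ...   | yes l+a≤c | _           = split-avoiding L (t⊆T ∘ apex-left) l+a≤c (inj₂ (≮⇒≥ i≮c))
  ...   | no _      | yes n+c<l+b = split-containing R (t⊆T ∘ apex-right) (≮⇒≥ i≮c) i<b n+c<l+b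
  ...   | no l+a≰c  | no n+c≮l+b  =
          outer-split (t⊆T (apex-right (root-edge R))) (≮⇒≥ n+c≮l+b , n+c+2≤b+2l) (≮⇒≥ i≮c) i<b
    where
    n+c+2≤b+2l : suc m + c + 2 ≤ b + 2 * l
    n+c+2≤b+2l = cancel-≤ a (+-mono-≤ (≰⇒> l+a≰c) n+a<l+b)
                   (solve (m ∷ a ∷ c ∷ [])) (solve (l ∷ a ∷ b ∷ []))

lemma4 : (l n : ℕ) → 2 ≤ l → 2 * l ≤ n → (T : MOP n) → (i : ℕ) → i < n →
    ∃[ a ] ∃[ b ] (Diagonal n T a b ×
      ((¬ innerHasBoundaryEdge a b i × suc l ≤ innerOrder a b × innerOrder a b ≤ 2 * l ∸ 1)
       ⊎ (¬ outerHasBoundaryEdge a b i × suc l ≤ outerOrder n a b × outerOrder n a b ≤ 2 * l ∸ 1)))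
lemma4 l zero    _   _    _ _ ()
lemma4 l (suc m) 2≤l 2l≤n T i _ with i <? m
... | yes i<m = split-containing 2≤l 2l≤n T id z≤n i<m n+0<l+m
  where
  n+0<l+m : suc m + 0 < l + m
  n+0<l+m = ≤-trans (≤-reflexive (cong (suc ∘ suc) (+-identityʳ m))) (+-monoˡ-≤ m 2≤l)
... | no i≮m = split-avoiding 2≤l 2l≤n T id l+0≤m (inj₂ (≮⇒≥ i≮m))
  where
  l+0≤m : l + 0 ≤ m
  l+0≤m = ≤-pred (≤-trans (+-monoˡ-≤ (l + 0) (≤-trans (s≤s z≤n) 2≤l)) 2l≤n)
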